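{- For any connected oriented graph $\vec\Gamma$ and any $M\in\{1,2,\dots\}\cup\{\infty\}$, all connected components of $\vec\Gamma\otimes\vec C_M$ are isomorphic (as oriented graphs).
   Context: Oriented graphs have vertices, edges and maps $\iota,\tau$; loops and multiple edges allowed; connectedness is in the non-oriented sense. The tensor product $\vec\Gamma\otimes\vec\Delta$ has vertex set $V(\vec\Gamma)\times V(\vec\Delta)$ and an edge $(e,f)$ from $(v_1,w_1)$ to $(v_2,w_2)$ for each edge $e\colon v_1\to v_2$ of $\vec\Gamma$ and $f\colon w_1\to w_2$ of $\vec\Delta$. $\vec C_M$ has vertex set $\mathbb Z/M\mathbb Z$ ($\mathbb Z$ if $M=\infty$) and one edge $i\to i+1$ for each $i$. -}

module Defs where

open import Data.Nat using (ℕ; suc; NonZero)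
open import Data.Nat.DivMod using (_mod_)
open import Data.Fin using (Fin; toℕ)
open import Data.Integer using (ℤ) renaming (suc to sucℤ)
open import Data.Product using (Σ; _×_; _,_; proj₁)
open import Relation.Binary.PropositionalEquality using (_≡_)

record OGraph : Set₁ where
  field
    V : Set
    E : Set
    ι : E → V
    τ : E → V
open OGraph public

data Reach (Γ : OGraph) (v : V Γ) : V Γ → Set where
  here : Reach Γ v v
  fwd  : (e : E Γ) → Reach Γ v (ι Γ e) → Reach Γ v (τ Γ e)
  bwd  : (e : E Γ) → Reach Γ v (τ Γ e) → Reach Γ v (ι Γ e)

Connected : OGraph → Set
Connected Γ = (v w : V Γ) → Reach Γ v w

_⊗_ : OGraph → OGraph → OGraph
Γ ⊗ Δ = record
  { V = V Γ × V Δ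
  ; E = E Γ × E Δ
  ; ι = λ { (e , f) → ι Γ e , ι Δ f }
  ; τ = λ { (e , f) → τ Γ e , τ Δ f }
  }

data Len : Set where
  fin : (M : ℕ) → .{{_ : NonZero M}} → Len
  ∞   : Len

C : Len → OGraph
C (fin M) = record
  { V = Fin M ; E = Fin M ; ι = λ i → i ; τ = λ i → suc (toℕ i) mod M }
C ∞ = record
  { V = ℤ ; E = ℤ ; ι = λ i → i ; τ = λ i → sucℤ i }

-- Since walks are proof-relevant,
-- two elements of the component are identified when their underlying vertices/edges
-- are equal; the isomorphism notion below respects this.
CompV : (Γ : OGraph) → V Γ → Set
CompV Γ x = Σ (V Γ) (Reach Γ x)

CompE : (Γ : OGraph) → V Γ → Set
CompE Γ x = Σ (E Γ) (λ e → Reach Γ x (ι Γ e))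

record ComponentIso (Γ : OGraph) (x : V Γ) (Δ : OGraph) (y : V Δ) : Set where
  field
    fV : CompV Γ x → CompV Δ y
    gV : CompV Δ y → CompV Γ x
    fE : CompE Γ x → CompE Δ y
    gE : CompE Δ y → CompE Γ x
    fV-wd : ∀ a b → proj₁ a ≡ proj₁ b → proj₁ (fV a) ≡ proj₁ (fV b)
    gV-wd : ∀ a b → proj₁ a ≡ proj₁ b → proj₁ (gV a) ≡ proj₁ (gV b)
    fE-wd : ∀ a b → proj₁ a ≡ proj₁ b → proj₁ (fE a) ≡ proj₁ (fE b)
    gE-wd : ∀ a b → proj₁ a ≡ proj₁ b → proj₁ (gE a) ≡ proj₁ (gE b)
    gfV : ∀ a → proj₁ (gV (fV a)) ≡ proj₁ a
    fgV : ∀ b → proj₁ (fV (gV b)) ≡ proj₁ b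
    gfE : ∀ a → proj₁ (gE (fE a)) ≡ proj₁ a
    fgE : ∀ b → proj₁ (fE (gE b)) ≡ proj₁ b
    fι : ∀ (a : CompE Γ x) → proj₁ (fV (ι Γ (proj₁ a) , Data.Product.proj₂ a))
                             ≡ ι Δ (proj₁ (fE a))
    fτ : ∀ (a : CompE Γ x) (p : Reach Γ x (τ Γ (proj₁ a)))
         → proj₁ (fV (τ Γ (proj₁ a) , p)) ≡ τ Δ (proj₁ (fE a))

-- Every automorphism φ of the cycle C_M (a rotation) gives an automorphism id ⊗ φ of
-- Γ ⊗ C_M, and rotations act transitively on C_M.  Since Γ is connected and every
-- vertex of C_M has exactly one outgoing and one incoming edge, a walk from w to v in Γ
-- lifts to a walk from (w , j) to some (v , k); the rotation taking i to k then carries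
-- the component of (v , i) onto that of (w , j).
module Submission where

open import Defs
open import Data.Nat using (ℕ; zero; suc; _+_; _%_)
open import Data.Nat.DivMod using (_mod_; %-distribˡ-+; m%n%n≡m%n; %-remove-+ˡ; m<n⇒m%n≡m)
open import Data.Nat.Divisibility using (∣-refl)
open import Data.Nat.GeneralisedArithmetic using (fold; fold-+)
open import Data.Nat.Properties using (+-comm; +-identityʳ)
open import Data.Fin as Fin using (Fin; toℕ)
open import Data.Fin.Properties using (toℕ-fromℕ<; toℕ-injective; toℕ<n)
open import Data.Integer as ℤ using (ℤ; +_; -[1+_])
open import Data.Integer.Properties using (pred-suc; suc-pred)
open import Data.Product using (∃; _×_; _,_; proj₁; map₂)
open import Function using (id; _∘_)
open import Relation.Binary.PropositionalEquality

module _ (Γ : OGraph) where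

  Reach-trans : ∀ {u v w} → Reach Γ u v → Reach Γ v w → Reach Γ u w
  Reach-trans p here      = p
  Reach-trans p (fwd e q) = fwd e (Reach-trans p q)
  Reach-trans p (bwd e q) = bwd e (Reach-trans p q)

  Reach-sym : ∀ {v w} → Reach Γ v w → Reach Γ w v
  Reach-sym here      = here
  Reach-sym (fwd e p) = Reach-trans (bwd e here) (Reach-sym p)
  Reach-sym (bwd e p) = Reach-trans (fwd e here) (Reach-sym p)

record Shift : Set₁ where
  field
    Carrier   : Set
    succ pred : Carrier → Carrier
    pred-succ : ∀ i → pred (succ i) ≡ i
    succ-pred : ∀ i → succ (pred i) ≡ i

shiftGraph : Shift → OGraph
shiftGraph S = record { V = Carrier ; E = Carrier ; ι = id ; τ = succ }
  where open Shift S

record Automorphism (S : Shift) : Set where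
  open Shift S
  field
    to from : Carrier → Carrier
    from-to : ∀ i → from (to i) ≡ i
    to-from : ∀ i → to (from i) ≡ i
    to-succ : ∀ i → to (succ i) ≡ succ (to i)
open Automorphism public

Homogeneous : Shift → Set
Homogeneous S = ∀ i j → ∃ λ (φ : Automorphism S) → to φ i ≡ j

succᴬ : (S : Shift) → Automorphism S
succᴬ S = record
  { to = succ ; from = pred ; from-to = pred-succ ; to-from = succ-pred ; to-succ = λ _ → refl }
  where open Shift S

module _ {S : Shift} where
  open Shift S

  from-succ : (φ : Automorphism S) → ∀ i → from φ (succ i) ≡ succ (from φ i)
  from-succ φ i = begin
    from φ (succ i)                   ≡⟨ cong (from φ ∘ succ) (to-from φ i) ⟨
    from φ (succ (to φ (from φ i)))   ≡⟨ cong (from φ) (to-succ φ (from φ i)) ⟨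
    from φ (to φ (succ (from φ i)))   ≡⟨ from-to φ _ ⟩
    succ (from φ i)                   ∎
    where open ≡-Reasoning

  idᴬ : Automorphism S
  idᴬ = record
    { to = id ; from = id ; from-to = λ _ → refl ; to-from = λ _ → refl ; to-succ = λ _ → refl }

  _∘ᴬ_ : Automorphism S → Automorphism S → Automorphism S
  φ ∘ᴬ ψ = record
    { to      = to φ ∘ to ψ
    ; from    = from ψ ∘ from φ
    ; from-to = λ i → trans (cong (from ψ) (from-to φ (to ψ i))) (from-to ψ i)
    ; to-from = λ i → trans (cong (to φ) (to-from ψ (from φ i))) (to-from φ i)
    ; to-succ = λ i → trans (cong (to φ) (to-succ ψ i)) (to-succ φ (to ψ i))
    }

  _⁻¹ : Automorphism S → Automorphism S
  φ ⁻¹ = record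
    { to = from φ ; from = to φ ; from-to = to-from φ ; to-from = from-to φ ; to-succ = from-succ φ }

  _^_ : Automorphism S → ℕ → Automorphism S
  φ ^ zero  = idᴬ
  φ ^ suc n = φ ∘ᴬ (φ ^ n)

  to-^ : (φ : Automorphism S) → ∀ n i → to (φ ^ n) i ≡ fold i (to φ) n
  to-^ φ zero    i = refl
  to-^ φ (suc n) i = cong (to φ) (to-^ φ n i)

  homogeneous-from-base : (o : Carrier) → (∀ j → ∃ λ (φ : Automorphism S) → to φ o ≡ j)
                        → Homogeneous S
  homogeneous-from-base o reach i j with reach i | reach j
  ... | φ , φo≡i | ψ , ψo≡j =
    ψ ∘ᴬ (φ ⁻¹) , trans (cong (to ψ) (trans (cong (from φ) (sym φo≡i)) (from-to φ o))) ψo≡j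

module _ {S : Shift} (Γ : OGraph) where
  open Shift S

  private
    G : OGraph
    G = Γ ⊗ shiftGraph S

  Reach-lift : ∀ {v w} → Reach Γ v w → ∀ i → ∃ λ k → Reach G (v , i) (w , k)
  Reach-lift here      i = i , here
  Reach-lift (fwd e p) i with Reach-lift p i
  ... | k , q = succ k , fwd (e , k) q
  Reach-lift (bwd e p) i with Reach-lift p i
  ... | k , q = pred k , bwd (e , pred k) (subst (λ l → Reach G _ (τ Γ e , l)) (sym (succ-pred k)) q)

  id⊗_ : Automorphism S → {A : Set} → A × Carrier → A × Carrier
  id⊗ φ = map₂ (to φ)

  id⊗-inverseˡ : (φ : Automorphism S) {A : Set} (z : A × Carrier) → (id⊗ (φ ⁻¹)) ((id⊗ φ) z) ≡ z
  id⊗-inverseˡ φ (a , i) = cong (a ,_) (from-to φ i)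

  Reach-id⊗ : (φ : Automorphism S) → ∀ {a b} → Reach G a b → Reach G ((id⊗ φ) a) ((id⊗ φ) b)
  Reach-id⊗ φ here = here
  Reach-id⊗ φ (fwd (e , i) p) =
    subst (λ l → Reach G _ (τ Γ e , l)) (sym (to-succ φ i)) (fwd (e , to φ i) (Reach-id⊗ φ p))
  Reach-id⊗ φ (bwd (e , i) p) =
    bwd (e , to φ i) (subst (λ l → Reach G _ (τ Γ e , l)) (to-succ φ i) (Reach-id⊗ φ p))

  module _ (φ : Automorphism S) {x y : V G} (y↝φx : Reach G y ((id⊗ φ) x)) where

    componentV-map : CompV G x → CompV G y
    componentV-map (z , x↝z) = (id⊗ φ) z , Reach-trans G y↝φx (Reach-id⊗ φ x↝z)

    componentE-map : CompE G x → CompE G y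
    componentE-map (f , x↝ιf) = (id⊗ φ) f , Reach-trans G y↝φx (Reach-id⊗ φ x↝ιf)

    x↝φ⁻¹y : Reach G x ((id⊗ (φ ⁻¹)) y)
    x↝φ⁻¹y = Reach-sym G (subst (Reach G _) (id⊗-inverseˡ φ x) (Reach-id⊗ (φ ⁻¹) y↝φx))

  ComponentIso-id⊗ : (φ : Automorphism S) → ∀ {x y} → Reach G y ((id⊗ φ) x) → ComponentIso G x G y
  ComponentIso-id⊗ φ y↝φx = record
    { fV    = componentV-map φ y↝φx
    ; gV    = componentV-map (φ ⁻¹) (x↝φ⁻¹y φ y↝φx)
    ; fE    = componentE-map φ y↝φx
    ; gE    = componentE-map (φ ⁻¹) (x↝φ⁻¹y φ y↝φx)
    ; fV-wd = λ _ _ → cong (id⊗ φ)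
    ; gV-wd = λ _ _ → cong (id⊗ (φ ⁻¹))
    ; fE-wd = λ _ _ → cong (id⊗ φ)
    ; gE-wd = λ _ _ → cong (id⊗ (φ ⁻¹))
    ; gfV   = λ a → id⊗-inverseˡ φ (proj₁ a)
    ; fgV   = λ b → id⊗-inverseˡ (φ ⁻¹) (proj₁ b)
    ; gfE   = λ a → id⊗-inverseˡ φ (proj₁ a)
    ; fgE   = λ b → id⊗-inverseˡ (φ ⁻¹) (proj₁ b)
    ; fι    = λ _ → refl
    ; fτ    = λ { ((e , i) , _) _ → cong (τ Γ e ,_) (to-succ φ i) }
    }

  components-isomorphic : Connected Γ → Homogeneous S → ∀ x y → ComponentIso G x G y
  components-isomorphic conn hom (v , i) (w , j) with Reach-lift (conn w v) j
  ... | k , wj↝vk with hom i k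
  ... | φ , φi≡k =
    ComponentIso-id⊗ φ (subst (λ l → Reach G (w , j) (v , l)) (sym φi≡k) wj↝vk)

ℤShift : Shift
ℤShift = record
  { Carrier = ℤ ; succ = ℤ.suc ; pred = ℤ.pred ; pred-succ = pred-suc ; succ-pred = suc-pred }

ℤShift-homogeneous : Homogeneous ℤShift
ℤShift-homogeneous = homogeneous-from-base (+ 0) reach
  where
  fold-suc : ∀ n → fold (+ 0) ℤ.suc n ≡ + n
  fold-suc zero    = refl
  fold-suc (suc n) = cong ℤ.suc (fold-suc n)

  fold-pred : ∀ n → fold (+ 0) ℤ.pred (suc n) ≡ -[1+ n ]
  fold-pred zero    = refl
  fold-pred (suc n) = cong ℤ.pred (fold-pred n)

  reach : ∀ j → ∃ λ (φ : Automorphism ℤShift) → to φ (+ 0) ≡ j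
  reach (+ n)    = succᴬ ℤShift ^ n , trans (to-^ (succᴬ ℤShift) n (+ 0)) (fold-suc n)
  reach -[1+ n ] =
    (succᴬ ℤShift ⁻¹) ^ suc n , trans (to-^ (succᴬ ℤShift ⁻¹) (suc n) (+ 0)) (fold-pred n)

module _ (m : ℕ) where

  succFin : Fin (suc m) → Fin (suc m)
  succFin i = suc (toℕ i) mod suc m

  private
    [1+a%n]%n≡[1+a]%n : ∀ a → suc (a % suc m) % suc m ≡ suc a % suc m
    [1+a%n]%n≡[1+a]%n a = begin
      (1 + a % suc m) % suc m                       ≡⟨ %-distribˡ-+ 1 (a % suc m) (suc m) ⟩
      (1 % suc m + a % suc m % suc m) % suc m       ≡⟨ cong (λ r → (1 % suc m + r) % suc m) (m%n%n≡m%n a (suc m)) ⟩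
      (1 % suc m + a % suc m) % suc m               ≡⟨ %-distribˡ-+ 1 a (suc m) ⟨
      (1 + a) % suc m                               ∎
      where open ≡-Reasoning

  toℕ-fold-succFin : ∀ n i → toℕ (fold i succFin n) ≡ (n + toℕ i) % suc m
  toℕ-fold-succFin zero    i = sym (m<n⇒m%n≡m (toℕ<n i))
  toℕ-fold-succFin (suc n) i = begin
    toℕ (succFin (fold i succFin n))       ≡⟨ toℕ-fromℕ< _ ⟩
    suc (toℕ (fold i succFin n)) % suc m   ≡⟨ cong (λ r → suc r % suc m) (toℕ-fold-succFin n i) ⟩
    suc ((n + toℕ i) % suc m) % suc m      ≡⟨ [1+a%n]%n≡[1+a]%n (n + toℕ i) ⟩
    suc (n + toℕ i) % suc m                ∎
    where open ≡-Reasoning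

  fold-succFin-period : ∀ i → fold i succFin (suc m) ≡ i
  fold-succFin-period i = toℕ-injective (begin
    toℕ (fold i succFin (suc m))   ≡⟨ toℕ-fold-succFin (suc m) i ⟩
    (suc m + toℕ i) % suc m        ≡⟨ %-remove-+ˡ (toℕ i) ∣-refl ⟩
    toℕ i % suc m                  ≡⟨ m<n⇒m%n≡m (toℕ<n i) ⟩
    toℕ i                          ∎)
    where open ≡-Reasoning

  finShift : Shift
  finShift = record
    { Carrier   = Fin (suc m)
    ; succ      = succFin
    ; pred      = λ i → fold i succFin m
    ; pred-succ = λ i → trans (trans (sym (fold-+ i succFin m)) (cong (fold i succFin) (+-comm m 1)))
                              (fold-succFin-period i)
    ; succ-pred = fold-succFin-period
    }

  finShift-homogeneous : Homogeneous finShift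
  finShift-homogeneous = homogeneous-from-base Fin.zero reach
    where
    reach : ∀ j → ∃ λ (φ : Automorphism finShift) → to φ Fin.zero ≡ j
    reach j = succᴬ finShift ^ toℕ j , toℕ-injective (begin
      toℕ (to (succᴬ finShift ^ toℕ j) Fin.zero)   ≡⟨ cong toℕ (to-^ (succᴬ finShift) (toℕ j) Fin.zero) ⟩
      toℕ (fold Fin.zero succFin (toℕ j))           ≡⟨ toℕ-fold-succFin (toℕ j) Fin.zero ⟩
      (toℕ j + 0) % suc m                           ≡⟨ cong (_% suc m) (+-identityʳ (toℕ j)) ⟩
      toℕ j % suc m                                 ≡⟨ m<n⇒m%n≡m (toℕ<n j) ⟩
      toℕ j                                         ∎)
      where open ≡-Reasoning

proposition3p7 : (Γ : OGraph) → Connected Γ → (M : Len)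
    → (x y : V (Γ ⊗ C M)) → ComponentIso (Γ ⊗ C M) x (Γ ⊗ C M) y
proposition3p7 Γ conn (fin (suc m)) = components-isomorphic Γ conn (finShift-homogeneous m)
proposition3p7 Γ conn ∞             = components-isomorphic Γ conn ℤShift-homogeneous
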